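{- For every command $c$ and list $vs$ of variables, $\mathrm{cFrame}(c,vs)$ implies $vs\Vdash c$; and for every bicom $B$, $\mathrm{biFrame}(B,vs)$ implies $vs\Vdash B$.
   Context: Variables are integer or boolean; a store is a total function from variables to values of the appropriate type; $\mathsf{Store}$ is the set of stores; $s[x\mapsto n]$ is the update. Expressions are arbitrary functions on stores; assertions are subsets of $\mathsf{Store}$; relations subsets of $\mathsf{Store}^2$; a two-state expression is $E:\mathsf{Store}^2\to\mathbb Z$. Commands: $c::=\mathsf{skip}\mid x:=e\mid\mathsf{hav}\ x\mid\mathsf{assert}\ p\mid c;c\mid\mathsf{if}\ e\ \mathsf{then}\ c\ \mathsf{else}\ c\mid\mathsf{while}\ e\ \mathsf{vnt}\ e_1\ \mathsf{do}\ c$ ($e_1$ an integer variant with no semantic effect), standard big-step semantics $c/s\Downarrow\phi$, $\phi\in\mathsf{Store}\cup\{\mathsf{fail}\}$ ($\mathsf{hav}\ x$ assigns any value of $x$'s type, $\mathsf{assert}\ p$ fails outside $p$, failure propagates). Bicoms: $B::=\langle c|c'\rangle\mid\mathsf{assert}\ \mathcal P\mid\mathsf{havf}\ x\ \mathcal P\mid B;B\mid\mathsf{if}\ e|e'\ B_1B_2B_3B_4\mid\mathsf{while}\ e|e'\ \mathsf{algn}\ \mathcal L|\mathcal R\ \mathsf{vnt}\ E\ \mathsf{do}\ B$. Projections: $\mathrm{L}$ maps $\langle c|c'\rangle\mapsto c$, assert/havf$\mapsto\mathsf{skip}$, homomorphic on sequence, bi-if$\mapsto\mathsf{if}\ e\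 \mathsf{then}\ \mathrm{L}(B_1)\ \mathsf{else}\ \mathrm{L}(B_3)$, bi-while$\mapsto\mathsf{while}\ e\ \mathsf{do}\ \mathrm{L}(B)$; $\mathrm{biL}(B)=\langle\mathrm{L}(B)|\mathsf{skip}\rangle$; $\mathrm{biR}$ maps $\langle c|c'\rangle\mapsto\langle\mathsf{skip}|c'\rangle$, keeps assert and havf, is homomorphic on sequence, maps $\mathsf{if}\ e|e'\ B_1..B_4\mapsto\mathsf{if}\ \mathrm{tt}|e'\ \mathrm{biR}(B_1)..\mathrm{biR}(B_4)$ and $\mathsf{while}\ e|e'\ \mathsf{algn}\ \mathcal L|\mathcal R\ \mathsf{vnt}\ E\ \mathsf{do}\ B\mapsto\mathsf{while}\ \mathrm{ff}|e'\ \mathsf{algn}\ \emptyset|\mathcal R\ \mathsf{vnt}\ E\ \mathsf{do}\ \mathrm{biR}(B)$. Semantics $B/(s,s')\Downarrow\varphi$: embed fails if $c/s$ fails or ($c/s\Downarrow t$ and $c'/s'$ fails), else yields $(t,t')$ for $c/s\Downarrow t$, $c'/s'\Downarrow t'$; $\mathsf{assert}\ \mathcal P$ yields $(s,s')$ if $(s,s')\in\mathcal P$, else fails; $\mathsf{havf}\ x\ \mathcal P$ yields $(s,s'[x\mapsto n])$ for each value $n$ with $(s,s'[x\mapsto n])\in\mathcal P$; sequence as usual with failure propagation; bi-if runs $B_1..B_4$ according as ($s\models e,s'\models e'$), ($s\models e,s'\not\models e'$), ($s\not\models e,s'\models e'$), (neither); for bi-while $W$: stop with $(s,s')$ if $s\not\models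 e,s'\not\models e'$; if $s\models e$ and $(s,s')\in\mathcal L$ run $\mathrm{biL}(B)$ then $W$ (failure propagates); otherwise if $s'\models e'$ and $(s,s')\in\mathcal R$ run $\mathrm{biR}(B)$ then $W$; if $s\models e$, $s'\models e'$, $(s,s')\notin\mathcal L\cup\mathcal R$ run $B$ then $W$; fail if ($s\models e,s'\not\models e',(s,s')\notin\mathcal L$) or ($s\not\models e,s'\models e',(s,s')\notin\mathcal R$). For a list $vs$, $s=_{vs}t$ iff $s(x)=t(x)$ for all $x\in vs$. $vs\Vdash e$ iff $s=_{vs}t\Rightarrow e(s)=e(t)$; $vs\Vdash p$ iff $s=_{vs}t\Rightarrow(s\in p\iff t\in p)$; $vs\Vdash E$ iff $s=_{vs}t\wedge s'=_{vs}t'\Rightarrow E(s,s')=E(t,t')$; $vs\Vdash\mathcal R$ iff $s=_{vs}t\wedge s'=_{vs}t'\Rightarrow((s,s')\in\mathcal R\iff(t,t')\in\mathcal R)$. $vs\Vdash c$ iff ($s=_{vs}s'$ and $c/s\Downarrow t$ imply some $t'$ with $c/s'\Downarrow t'$, $t=_{vs}t'$) and ($s=_{vs}s'$ and $c/s\Downarrow\mathsf{fail}$ imply $c/s'\Downarrow\mathsf{fail}$). $vs\Vdash B$ iff ($s=_{vs}t$, $s'=_{vs}t'$, $B/(s,s')\Downarrow(u,u')$ imply some $(v,v')$ with $B/(t,t')\Downarrow(v,v')$, $u=_{vs}v$, $u'=_{vs}v'$) and ($s=_{vs}t$, $s'=_{vs}t'$, $B/(s,s')\Downarrow\mathsf{fail}$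 imply $B/(t,t')\Downarrow\mathsf{fail}$). $\mathrm{cFrame}(c,vs)$: $\mathrm{tt}$ for $\mathsf{skip}$; $x\in vs\wedge vs\Vdash e$ for $x:=e$; $x\in vs$ for $\mathsf{hav}\ x$; $vs\Vdash p$ for $\mathsf{assert}\ p$; conjunction for sequence; $vs\Vdash e$ and both branches for if; $vs\Vdash e\wedge vs\Vdash e_1\wedge\mathrm{cFrame}(c_1,vs)$ for $\mathsf{while}\ e\ \mathsf{vnt}\ e_1\ \mathsf{do}\ c_1$. $\mathrm{biFrame}(B,vs)$: $\mathrm{cFrame}(c,vs)\wedge\mathrm{cFrame}(c',vs)$ for $\langle c|c'\rangle$; $vs\Vdash\mathcal P$ for $\mathsf{assert}\ \mathcal P$; $x\in vs\wedge vs\Vdash\mathcal P$ for $\mathsf{havf}\ x\ \mathcal P$; conjunction for sequence; $vs\Vdash e$, $vs\Vdash e'$ and all four components for bi-if; $vs\Vdash e,e',\mathcal L,\mathcal R,E$ and $\mathrm{biFrame}$ of the body for bi-while. -}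

module Defs where

open import Data.Nat using (ℕ)
import Data.Nat as ℕ
open import Data.Integer using (ℤ; 0ℤ)
open import Data.Bool using (Bool; true; false)
open import Data.List using (List)
open import Data.List.Membership.Propositional using (_∈_)
open import Data.Product using (_×_; _,_; Σ)
open import Data.Empty using (⊥)
open import Data.Unit using (⊤)
open import Relation.Binary.PropositionalEquality using (_≡_; refl; cong)
open import Relation.Nullary using (¬_; Dec; yes; no)
open import Function.Bundles using (_⇔_)

data Ty : Set where
  tint tbool : Ty

Val : Ty → Set
Val tint  = ℤ
Val tbool = Bool

-- infinitely many variables of each type: a name and a type
data Var : Set where
  var : ℕ → Ty → Var

ty : Var → Ty
ty (var _ t) = t

_≟Ty_ : (a b : Ty) → Dec (a ≡ b)
tint  ≟Ty tint  = yes refl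
tint  ≟Ty tbool = no (λ ())
tbool ≟Ty tint  = no (λ ())
tbool ≟Ty tbool = yes refl

_≟V_ : (x y : Var) → Dec (x ≡ y)
var n a ≟V var m b with n ℕ.≟ m | a ≟Ty b
... | yes refl | yes refl = yes refl
... | no n≢m   | _        = no (λ { refl → n≢m refl })
... | yes _    | no a≢b   = no (λ { refl → a≢b refl })

Store : Set
Store = (x : Var) → Val (ty x)

_[_↦_] : Store → (x : Var) → Val (ty x) → Store
(s [ x ↦ v ]) y with x ≟V y
... | yes refl = v
... | no _     = s y

-- Commands (expressions / assertions / relations are semantic)

data Cmd : Set₁ where
  skip   : Cmd
  _:=_   : (x : Var) → (Store → Val (ty x)) → Cmd
  hav    : Var → Cmd
  assert : (Store → Set) → Cmd
  _⨾_    : Cmd → Cmd → Cmd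
  cif    : (Store → Bool) → Cmd → Cmd → Cmd
  -- while e vnt e₁ do c
  cwhile : (Store → Bool) → (Store → ℤ) → Cmd → Cmd

data Res : Set where
  ok   : Store → Res
  fail : Res

infix 4 _/_⇓_
data _/_⇓_ : Cmd → Store → Res → Set₁ where
  skip⇓    : ∀ {s} → skip / s ⇓ ok s
  assign⇓  : ∀ {s x e} → (x := e) / s ⇓ ok (s [ x ↦ e s ])
  hav⇓     : ∀ {s x} (n : Val (ty x)) → hav x / s ⇓ ok (s [ x ↦ n ])
  assertT⇓ : ∀ {s p} → p s → assert p / s ⇓ ok s
  assertF⇓ : ∀ {s p} → ¬ p s → assert p / s ⇓ fail
  seq⇓     : ∀ {s t φ c₁ c₂} → c₁ / s ⇓ ok t → c₂ / t ⇓ φ → (c₁ ⨾ c₂) / s ⇓ φ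
  seqF⇓    : ∀ {s c₁ c₂} → c₁ / s ⇓ fail → (c₁ ⨾ c₂) / s ⇓ fail
  ifT⇓     : ∀ {s φ e c₁ c₂} → e s ≡ true → c₁ / s ⇓ φ → cif e c₁ c₂ / s ⇓ φ
  ifF⇓     : ∀ {s φ e c₁ c₂} → e s ≡ false → c₂ / s ⇓ φ → cif e c₁ c₂ / s ⇓ φ
  whileF⇓  : ∀ {s e e₁ c} → e s ≡ false → cwhile e e₁ c / s ⇓ ok s
  whileT⇓  : ∀ {s t φ e e₁ c} → e s ≡ true → c / s ⇓ ok t →
             cwhile e e₁ c / t ⇓ φ → cwhile e e₁ c / s ⇓ φ
  whileE⇓  : ∀ {s e e₁ c} → e s ≡ true → c / s ⇓ fail → cwhile e e₁ c / s ⇓ fail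

Rel₂ : Set₁
Rel₂ = Store → Store → Set

data BiCmd : Set₁ where
  ⟨_∣_⟩   : Cmd → Cmd → BiCmd
  bassert : Rel₂ → BiCmd
  havf    : Var → Rel₂ → BiCmd
  _⨾ᵇ_    : BiCmd → BiCmd → BiCmd
  bif     : (e e' : Store → Bool) → (B₁ B₂ B₃ B₄ : BiCmd) → BiCmd
  -- while e|e' algn L|R vnt E do B
  bwhile  : (e e' : Store → Bool) → (L R : Rel₂) → (E : Store → Store → ℤ) → BiCmd → BiCmd

-- left projection; the (semantically irrelevant) variant of the projected
-- loop is chosen to be the constant 0
projL : BiCmd → Cmd
projL ⟨ c ∣ c' ⟩ = c
projL (bassert P) = skip
projL (havf x P) = skip
projL (B₁ ⨾ᵇ B₂) = projL B₁ ⨾ projL B₂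
projL (bif e e' B₁ B₂ B₃ B₄) = cif e (projL B₁) (projL B₃)
projL (bwhile e e' L R E B) = cwhile e (λ _ → 0ℤ) (projL B)

biL : BiCmd → BiCmd
biL B = ⟨ projL B ∣ skip ⟩

biR : BiCmd → BiCmd
biR ⟨ c ∣ c' ⟩ = ⟨ skip ∣ c' ⟩
biR (bassert P) = bassert P
biR (havf x P) = havf x P
biR (B₁ ⨾ᵇ B₂) = biR B₁ ⨾ᵇ biR B₂
biR (bif e e' B₁ B₂ B₃ B₄) = bif (λ _ → true) e' (biR B₁) (biR B₂) (biR B₃) (biR B₄)
biR (bwhile e e' L R E B) = bwhile (λ _ → false) e' (λ _ _ → ⊥) R E (biR B)

data BRes : Set where
  bok   : Store → Store → BRes
  bfail : BRes

infix 4 _/⟨_,_⟩⇓_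
data _/⟨_,_⟩⇓_ : BiCmd → Store → Store → BRes → Set₁ where
  emb⇓      : ∀ {c c' s s' t t'} → c / s ⇓ ok t → c' / s' ⇓ ok t' →
              ⟨ c ∣ c' ⟩ /⟨ s , s' ⟩⇓ bok t t'
  embF₁⇓    : ∀ {c c' s s'} → c / s ⇓ fail → ⟨ c ∣ c' ⟩ /⟨ s , s' ⟩⇓ bfail
  embF₂⇓    : ∀ {c c' s s' t} → c / s ⇓ ok t → c' / s' ⇓ fail →
              ⟨ c ∣ c' ⟩ /⟨ s , s' ⟩⇓ bfail
  assertT⇓  : ∀ {P s s'} → P s s' → bassert P /⟨ s , s' ⟩⇓ bok s s'
  assertF⇓  : ∀ {P s s'} → ¬ P s s' → bassert P /⟨ s , s' ⟩⇓ bfail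
  havf⇓     : ∀ {x P s s'} (n : Val (ty x)) → P s (s' [ x ↦ n ]) →
              havf x P /⟨ s , s' ⟩⇓ bok s (s' [ x ↦ n ])
  seq⇓      : ∀ {B₁ B₂ s s' t t' φ} → B₁ /⟨ s , s' ⟩⇓ bok t t' →
              B₂ /⟨ t , t' ⟩⇓ φ → (B₁ ⨾ᵇ B₂) /⟨ s , s' ⟩⇓ φ
  seqF⇓     : ∀ {B₁ B₂ s s'} → B₁ /⟨ s , s' ⟩⇓ bfail → (B₁ ⨾ᵇ B₂) /⟨ s , s' ⟩⇓ bfail
  ifTT⇓     : ∀ {e e' B₁ B₂ B₃ B₄ s s' φ} → e s ≡ true → e' s' ≡ true →
              B₁ /⟨ s , s' ⟩⇓ φ → bif e e' B₁ B₂ B₃ B₄ /⟨ s , s' ⟩⇓ φ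
  ifTF⇓     : ∀ {e e' B₁ B₂ B₃ B₄ s s' φ} → e s ≡ true → e' s' ≡ false →
              B₂ /⟨ s , s' ⟩⇓ φ → bif e e' B₁ B₂ B₃ B₄ /⟨ s , s' ⟩⇓ φ
  ifFT⇓     : ∀ {e e' B₁ B₂ B₃ B₄ s s' φ} → e s ≡ false → e' s' ≡ true →
              B₃ /⟨ s , s' ⟩⇓ φ → bif e e' B₁ B₂ B₃ B₄ /⟨ s , s' ⟩⇓ φ
  ifFF⇓     : ∀ {e e' B₁ B₂ B₃ B₄ s s' φ} → e s ≡ false → e' s' ≡ false →
              B₄ /⟨ s , s' ⟩⇓ φ → bif e e' B₁ B₂ B₃ B₄ /⟨ s , s' ⟩⇓ φ
  wStop⇓    : ∀ {e e' L R E B s s'} → e s ≡ false → e' s' ≡ false →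
              bwhile e e' L R E B /⟨ s , s' ⟩⇓ bok s s'
  wL⇓       : ∀ {e e' L R E B s s' t t' φ} → e s ≡ true → L s s' →
              biL B /⟨ s , s' ⟩⇓ bok t t' →
              bwhile e e' L R E B /⟨ t , t' ⟩⇓ φ →
              bwhile e e' L R E B /⟨ s , s' ⟩⇓ φ
  wLF⇓      : ∀ {e e' L R E B s s'} → e s ≡ true → L s s' →
              biL B /⟨ s , s' ⟩⇓ bfail →
              bwhile e e' L R E B /⟨ s , s' ⟩⇓ bfail
  wR⇓       : ∀ {e e' L R E B s s' t t' φ} → ¬ (e s ≡ true × L s s') →
              e' s' ≡ true → R s s' →
              biR B /⟨ s , s' ⟩⇓ bok t t' →
              bwhile e e' L R E B /⟨ t , t' ⟩⇓ φ →
              bwhile e e' L R E B /⟨ s , s' ⟩⇓ φ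
  wRF⇓      : ∀ {e e' L R E B s s'} → ¬ (e s ≡ true × L s s') →
              e' s' ≡ true → R s s' →
              biR B /⟨ s , s' ⟩⇓ bfail →
              bwhile e e' L R E B /⟨ s , s' ⟩⇓ bfail
  wB⇓       : ∀ {e e' L R E B s s' t t' φ} → e s ≡ true → e' s' ≡ true →
              ¬ L s s' → ¬ R s s' →
              B /⟨ s , s' ⟩⇓ bok t t' →
              bwhile e e' L R E B /⟨ t , t' ⟩⇓ φ →
              bwhile e e' L R E B /⟨ s , s' ⟩⇓ φ
  wBF⇓      : ∀ {e e' L R E B s s'} → e s ≡ true → e' s' ≡ true →
              ¬ L s s' → ¬ R s s' →
              B /⟨ s , s' ⟩⇓ bfail →
              bwhile e e' L R E B /⟨ s , s' ⟩⇓ bfail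
  wFailL⇓   : ∀ {e e' L R E B s s'} → e s ≡ true → e' s' ≡ false → ¬ L s s' →
              bwhile e e' L R E B /⟨ s , s' ⟩⇓ bfail
  wFailR⇓   : ∀ {e e' L R E B s s'} → e s ≡ false → e' s' ≡ true → ¬ R s s' →
              bwhile e e' L R E B /⟨ s , s' ⟩⇓ bfail

_=[_]_ : Store → List Var → Store → Set
s =[ vs ] t = ∀ {x} → x ∈ vs → s x ≡ t x

-- vs ⊩ e  (expressions of any value type, incl. the integer variants)
⊩exp : {A : Set} → List Var → (Store → A) → Set
⊩exp vs e = ∀ s t → s =[ vs ] t → e s ≡ e t

⊩asn : List Var → (Store → Set) → Set
⊩asn vs p = ∀ s t → s =[ vs ] t → (p s ⇔ p t)

⊩exp₂ : List Var → (Store → Store → ℤ) → Set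
⊩exp₂ vs E = ∀ s s' t t' → s =[ vs ] t → s' =[ vs ] t' → E s s' ≡ E t t'

⊩rel : List Var → Rel₂ → Set
⊩rel vs R = ∀ s s' t t' → s =[ vs ] t → s' =[ vs ] t' → (R s s' ⇔ R t t')

⊩cmd : List Var → Cmd → Set₁
⊩cmd vs c =
  (∀ s s' t → s =[ vs ] s' → c / s ⇓ ok t →
     Σ Store (λ t' → (c / s' ⇓ ok t') × (t =[ vs ] t')))
  × (∀ s s' → s =[ vs ] s' → c / s ⇓ fail → c / s' ⇓ fail)

⊩bi : List Var → BiCmd → Set₁
⊩bi vs B =
  (∀ s s' t t' u u' → s =[ vs ] t → s' =[ vs ] t' → B /⟨ s , s' ⟩⇓ bok u u' →
     Σ Store (λ v → Σ Store (λ v' →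
       (B /⟨ t , t' ⟩⇓ bok v v') × (u =[ vs ] v) × (u' =[ vs ] v'))))
  × (∀ s s' t t' → s =[ vs ] t → s' =[ vs ] t' → B /⟨ s , s' ⟩⇓ bfail →
       B /⟨ t , t' ⟩⇓ bfail)

cFrame : Cmd → List Var → Set
cFrame skip vs = ⊤
cFrame (x := e) vs = (x ∈ vs) × ⊩exp vs e
cFrame (hav x) vs = x ∈ vs
cFrame (assert p) vs = ⊩asn vs p
cFrame (c₁ ⨾ c₂) vs = cFrame c₁ vs × cFrame c₂ vs
cFrame (cif e c₁ c₂) vs = ⊩exp vs e × cFrame c₁ vs × cFrame c₂ vs
cFrame (cwhile e e₁ c) vs = ⊩exp vs e × ⊩exp vs e₁ × cFrame c vs

biFrame : BiCmd → List Var → Set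
biFrame ⟨ c ∣ c' ⟩ vs = cFrame c vs × cFrame c' vs
biFrame (bassert P) vs = ⊩rel vs P
biFrame (havf x P) vs = (x ∈ vs) × ⊩rel vs P
biFrame (B₁ ⨾ᵇ B₂) vs = biFrame B₁ vs × biFrame B₂ vs
biFrame (bif e e' B₁ B₂ B₃ B₄) vs =
  ⊩exp vs e × ⊩exp vs e' × biFrame B₁ vs × biFrame B₂ vs × biFrame B₃ vs × biFrame B₄ vs
biFrame (bwhile e e' L R E B) vs =
  ⊩exp vs e × ⊩exp vs e' × ⊩rel vs L × ⊩rel vs R × ⊩exp₂ vs E × biFrame B vs

-- The frame conditions make every guard,
-- assertion and alignment condition, and every assigned value, depend only on
-- the variables in vs, so a run from a vs-agreeing pair of states can take the
-- same rule at every step (choosing the same value at each havoc); assigned and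
-- havocked variables lie in vs, so agreement survives updates. The one-sided
-- loop iterations run the projections biL B and biR B, which inherit the frame
-- of B.
module Submission where

open import Defs
open import Data.List using (List)
open import Data.Product using (_×_; _,_; Σ)
import Data.Product as ×
open import Data.Unit using (tt)
open import Data.Bool using (Bool; true)
open import Relation.Binary.PropositionalEquality using (_≡_; refl; sym; trans)
open import Relation.Nullary using (¬_; yes; no)
open import Relation.Nullary.Negation using (contraposition)
open import Function.Bundles using (mk⇔; Equivalence)

module _ {vs : List Var} where

  =[]-sym : ∀ {s t} → s =[ vs ] t → t =[ vs ] s
  =[]-sym eq x∈ = sym (eq x∈)

  [↦]-agree : ∀ {s t} x {v w : Val (ty x)} → s =[ vs ] t → v ≡ w →
              (s [ x ↦ v ]) =[ vs ] (t [ x ↦ w ])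
  [↦]-agree x eq refl {y} y∈ with x ≟V y
  ... | yes refl = refl
  ... | no _     = eq y∈

  ⊩exp-transport : ∀ {A : Set} {e : Store → A} {s t b} →
                   ⊩exp vs e → s =[ vs ] t → e s ≡ b → e t ≡ b
  ⊩exp-transport fe eq h = trans (sym (fe _ _ eq)) h

  ⊩asn-transport : ∀ {p s t} → ⊩asn vs p → s =[ vs ] t → p s → p t
  ⊩asn-transport fp eq = Equivalence.to (fp _ _ eq)

  ⊩rel-transport : ∀ {R s s' t t'} → ⊩rel vs R → s =[ vs ] t → s' =[ vs ] t' → R s s' → R t t'
  ⊩rel-transport fR eq eq' = Equivalence.to (fR _ _ _ _ eq eq')

  ⊩rel-transport-¬ : ∀ {R s s' t t'} → ⊩rel vs R → s =[ vs ] t → s' =[ vs ] t' →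
                     ¬ R s s' → ¬ R t t'
  ⊩rel-transport-¬ fR eq eq' = contraposition (⊩rel-transport fR (=[]-sym eq) (=[]-sym eq'))

  projL-frame : ∀ B → biFrame B vs → cFrame (projL B) vs
  projL-frame ⟨ c ∣ c' ⟩ (f , _) = f
  projL-frame (bassert P) _ = tt
  projL-frame (havf x P) _ = tt
  projL-frame (B₁ ⨾ᵇ B₂) (f₁ , f₂) = projL-frame B₁ f₁ , projL-frame B₂ f₂
  projL-frame (bif e e' B₁ B₂ B₃ B₄) (fe , _ , f₁ , _ , f₃ , _) =
    fe , projL-frame B₁ f₁ , projL-frame B₃ f₃
  projL-frame (bwhile e e' L R E B) (fe , _ , _ , _ , _ , fB) =
    fe , (λ _ _ _ → refl) , projL-frame B fB

  biL-frame : ∀ B → biFrame B vs → biFrame (biL B) vs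
  biL-frame B f = projL-frame B f , tt

  biR-frame : ∀ B → biFrame B vs → biFrame (biR B) vs
  biR-frame ⟨ c ∣ c' ⟩ (_ , f') = tt , f'
  biR-frame (bassert P) f = f
  biR-frame (havf x P) f = f
  biR-frame (B₁ ⨾ᵇ B₂) (f₁ , f₂) = biR-frame B₁ f₁ , biR-frame B₂ f₂
  biR-frame (bif e e' B₁ B₂ B₃ B₄) (_ , fe' , f₁ , f₂ , f₃ , f₄) =
    (λ _ _ _ → refl) , fe' , biR-frame B₁ f₁ , biR-frame B₂ f₂ , biR-frame B₃ f₃ , biR-frame B₄ f₄
  biR-frame (bwhile e e' L R E B) (_ , fe' , _ , fR , fE , fB) =
    (λ _ _ _ → refl) , fe' , (λ _ _ _ _ _ _ → mk⇔ (λ ()) (λ ())) , fR , fE , biR-frame B fB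

  mutual
    cFrame-ok : ∀ {c s s' t} → cFrame c vs → s =[ vs ] s' → c / s ⇓ ok t →
                Σ Store λ t' → (c / s' ⇓ ok t') × (t =[ vs ] t')
    cFrame-ok _ eq skip⇓ = _ , skip⇓ , eq
    cFrame-ok (_ , fe) eq (assign⇓ {x = x}) = _ , assign⇓ , [↦]-agree x eq (fe _ _ eq)
    cFrame-ok _ eq (hav⇓ {x = x} n) = _ , hav⇓ n , [↦]-agree x eq refl
    cFrame-ok fp eq (assertT⇓ p) = _ , assertT⇓ (⊩asn-transport fp eq p) , eq
    cFrame-ok (f₁ , f₂) eq (seq⇓ d₁ d₂) =
      let (_ , d₁' , eq₁) = cFrame-ok f₁ eq d₁
          (_ , d₂' , eq₂) = cFrame-ok f₂ eq₁ d₂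
      in _ , seq⇓ d₁' d₂' , eq₂
    cFrame-ok (fe , f₁ , _) eq (ifT⇓ h d) =
      let (_ , d' , eq') = cFrame-ok f₁ eq d in _ , ifT⇓ (⊩exp-transport fe eq h) d' , eq'
    cFrame-ok (fe , _ , f₂) eq (ifF⇓ h d) =
      let (_ , d' , eq') = cFrame-ok f₂ eq d in _ , ifF⇓ (⊩exp-transport fe eq h) d' , eq'
    cFrame-ok (fe , _) eq (whileF⇓ h) = _ , whileF⇓ (⊩exp-transport fe eq h) , eq
    cFrame-ok f@(fe , _ , fc) eq (whileT⇓ h d₁ d₂) =
      let (_ , d₁' , eq₁) = cFrame-ok fc eq d₁
          (_ , d₂' , eq₂) = cFrame-ok f eq₁ d₂
      in _ , whileT⇓ (⊩exp-transport fe eq h) d₁' d₂' , eq₂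

    cFrame-fail : ∀ {c s s'} → cFrame c vs → s =[ vs ] s' → c / s ⇓ fail → c / s' ⇓ fail
    cFrame-fail fp eq (assertF⇓ np) = assertF⇓ (contraposition (⊩asn-transport fp (=[]-sym eq)) np)
    cFrame-fail (f₁ , f₂) eq (seq⇓ d₁ d₂) =
      let (_ , d₁' , eq₁) = cFrame-ok f₁ eq d₁ in seq⇓ d₁' (cFrame-fail f₂ eq₁ d₂)
    cFrame-fail (f₁ , _) eq (seqF⇓ d) = seqF⇓ (cFrame-fail f₁ eq d)
    cFrame-fail (fe , f₁ , _) eq (ifT⇓ h d) = ifT⇓ (⊩exp-transport fe eq h) (cFrame-fail f₁ eq d)
    cFrame-fail (fe , _ , f₂) eq (ifF⇓ h d) = ifF⇓ (⊩exp-transport fe eq h) (cFrame-fail f₂ eq d)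
    cFrame-fail f@(fe , _ , fc) eq (whileT⇓ h d₁ d₂) =
      let (_ , d₁' , eq₁) = cFrame-ok fc eq d₁
      in whileT⇓ (⊩exp-transport fe eq h) d₁' (cFrame-fail f eq₁ d₂)
    cFrame-fail (fe , _ , fc) eq (whileE⇓ h d) = whileE⇓ (⊩exp-transport fe eq h) (cFrame-fail fc eq d)

  ¬left-iteration-transport : ∀ {e : Store → Bool} {L s s' t t'} → ⊩exp vs e → ⊩rel vs L →
                              s =[ vs ] t → s' =[ vs ] t' →
                              ¬ (e s ≡ true × L s s') → ¬ (e t ≡ true × L t t')
  ¬left-iteration-transport fe fL eq eq' = contraposition
    (×.map (⊩exp-transport fe (=[]-sym eq)) (⊩rel-transport fL (=[]-sym eq) (=[]-sym eq')))

  mutual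
    biFrame-ok : ∀ {B s s' t t' u u'} → biFrame B vs → s =[ vs ] t → s' =[ vs ] t' →
                 B /⟨ s , s' ⟩⇓ bok u u' →
                 Σ Store λ v → Σ Store λ v' → (B /⟨ t , t' ⟩⇓ bok v v') × (u =[ vs ] v) × (u' =[ vs ] v')
    biFrame-ok (f , f') eq eq' (emb⇓ d d') =
      let (_ , d₁ , r) = cFrame-ok f eq d
          (_ , d₂ , r') = cFrame-ok f' eq' d'
      in _ , _ , emb⇓ d₁ d₂ , r , r'
    biFrame-ok fP eq eq' (assertT⇓ p) = _ , _ , assertT⇓ (⊩rel-transport fP eq eq' p) , eq , eq'
    biFrame-ok (_ , fP) eq eq' (havf⇓ {x = x} n p) =
      let eqₙ = [↦]-agree x eq' refl
      in _ , _ , havf⇓ n (⊩rel-transport fP eq eqₙ p) , eq , eqₙ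
    biFrame-ok (f₁ , f₂) eq eq' (seq⇓ d₁ d₂) =
      let (_ , _ , d₁' , r₁ , r₁') = biFrame-ok f₁ eq eq' d₁
          (_ , _ , d₂' , r₂ , r₂') = biFrame-ok f₂ r₁ r₁' d₂
      in _ , _ , seq⇓ d₁' d₂' , r₂ , r₂'
    biFrame-ok (fe , fe' , f₁ , _) eq eq' (ifTT⇓ h h' d) =
      let (_ , _ , d' , r) = biFrame-ok f₁ eq eq' d
      in _ , _ , ifTT⇓ (⊩exp-transport fe eq h) (⊩exp-transport fe' eq' h') d' , r
    biFrame-ok (fe , fe' , _ , f₂ , _) eq eq' (ifTF⇓ h h' d) =
      let (_ , _ , d' , r) = biFrame-ok f₂ eq eq' d
      in _ , _ , ifTF⇓ (⊩exp-transport fe eq h) (⊩exp-transport fe' eq' h') d' , r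
    biFrame-ok (fe , fe' , _ , _ , f₃ , _) eq eq' (ifFT⇓ h h' d) =
      let (_ , _ , d' , r) = biFrame-ok f₃ eq eq' d
      in _ , _ , ifFT⇓ (⊩exp-transport fe eq h) (⊩exp-transport fe' eq' h') d' , r
    biFrame-ok (fe , fe' , _ , _ , _ , f₄) eq eq' (ifFF⇓ h h' d) =
      let (_ , _ , d' , r) = biFrame-ok f₄ eq eq' d
      in _ , _ , ifFF⇓ (⊩exp-transport fe eq h) (⊩exp-transport fe' eq' h') d' , r
    biFrame-ok (fe , fe' , _) eq eq' (wStop⇓ h h') =
      _ , _ , wStop⇓ (⊩exp-transport fe eq h) (⊩exp-transport fe' eq' h') , eq , eq'
    biFrame-ok {B = bwhile _ _ _ _ _ B} f@(fe , _ , fL , _ , _ , fB) eq eq' (wL⇓ h l d₁ d₂) =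
      let (_ , _ , d₁' , r₁ , r₁') = biFrame-ok (biL-frame B fB) eq eq' d₁
          (_ , _ , d₂' , r₂) = biFrame-ok f r₁ r₁' d₂
      in _ , _ , wL⇓ (⊩exp-transport fe eq h) (⊩rel-transport fL eq eq' l) d₁' d₂' , r₂
    biFrame-ok {B = bwhile _ _ _ _ _ B} f@(fe , fe' , fL , fR , _ , fB) eq eq' (wR⇓ nl h' r d₁ d₂) =
      let (_ , _ , d₁' , r₁ , r₁') = biFrame-ok (biR-frame B fB) eq eq' d₁
          (_ , _ , d₂' , r₂) = biFrame-ok f r₁ r₁' d₂
      in _ , _ , wR⇓ (¬left-iteration-transport fe fL eq eq' nl) (⊩exp-transport fe' eq' h')
                     (⊩rel-transport fR eq eq' r) d₁' d₂' , r₂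
    biFrame-ok f@(fe , fe' , fL , fR , _ , fB) eq eq' (wB⇓ h h' nl nr d₁ d₂) =
      let (_ , _ , d₁' , r₁ , r₁') = biFrame-ok fB eq eq' d₁
          (_ , _ , d₂' , r₂) = biFrame-ok f r₁ r₁' d₂
      in _ , _ , wB⇓ (⊩exp-transport fe eq h) (⊩exp-transport fe' eq' h')
                     (⊩rel-transport-¬ fL eq eq' nl) (⊩rel-transport-¬ fR eq eq' nr) d₁' d₂' , r₂

    biFrame-fail : ∀ {B s s' t t'} → biFrame B vs → s =[ vs ] t → s' =[ vs ] t' →
                   B /⟨ s , s' ⟩⇓ bfail → B /⟨ t , t' ⟩⇓ bfail
    biFrame-fail (f , _) eq eq' (embF₁⇓ d) = embF₁⇓ (cFrame-fail f eq d)
    biFrame-fail (f , f') eq eq' (embF₂⇓ d d') =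
      let (_ , d₁ , _) = cFrame-ok f eq d in embF₂⇓ d₁ (cFrame-fail f' eq' d')
    biFrame-fail fP eq eq' (assertF⇓ np) = assertF⇓ (⊩rel-transport-¬ fP eq eq' np)
    biFrame-fail (f₁ , f₂) eq eq' (seq⇓ d₁ d₂) =
      let (_ , _ , d₁' , r₁ , r₁') = biFrame-ok f₁ eq eq' d₁
      in seq⇓ d₁' (biFrame-fail f₂ r₁ r₁' d₂)
    biFrame-fail (f₁ , _) eq eq' (seqF⇓ d) = seqF⇓ (biFrame-fail f₁ eq eq' d)
    biFrame-fail (fe , fe' , f₁ , _) eq eq' (ifTT⇓ h h' d) =
      ifTT⇓ (⊩exp-transport fe eq h) (⊩exp-transport fe' eq' h') (biFrame-fail f₁ eq eq' d)
    biFrame-fail (fe , fe' , _ , f₂ , _) eq eq' (ifTF⇓ h h' d) =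
      ifTF⇓ (⊩exp-transport fe eq h) (⊩exp-transport fe' eq' h') (biFrame-fail f₂ eq eq' d)
    biFrame-fail (fe , fe' , _ , _ , f₃ , _) eq eq' (ifFT⇓ h h' d) =
      ifFT⇓ (⊩exp-transport fe eq h) (⊩exp-transport fe' eq' h') (biFrame-fail f₃ eq eq' d)
    biFrame-fail (fe , fe' , _ , _ , _ , f₄) eq eq' (ifFF⇓ h h' d) =
      ifFF⇓ (⊩exp-transport fe eq h) (⊩exp-transport fe' eq' h') (biFrame-fail f₄ eq eq' d)
    biFrame-fail {B = bwhile _ _ _ _ _ B} f@(fe , _ , fL , _ , _ , fB) eq eq' (wL⇓ h l d₁ d₂) =
      let (_ , _ , d₁' , r₁ , r₁') = biFrame-ok (biL-frame B fB) eq eq' d₁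
      in wL⇓ (⊩exp-transport fe eq h) (⊩rel-transport fL eq eq' l) d₁' (biFrame-fail f r₁ r₁' d₂)
    biFrame-fail {B = bwhile _ _ _ _ _ B} (fe , _ , fL , _ , _ , fB) eq eq' (wLF⇓ h l d) =
      wLF⇓ (⊩exp-transport fe eq h) (⊩rel-transport fL eq eq' l) (biFrame-fail (biL-frame B fB) eq eq' d)
    biFrame-fail {B = bwhile _ _ _ _ _ B} f@(fe , fe' , fL , fR , _ , fB) eq eq' (wR⇓ nl h' r d₁ d₂) =
      let (_ , _ , d₁' , r₁ , r₁') = biFrame-ok (biR-frame B fB) eq eq' d₁
      in wR⇓ (¬left-iteration-transport fe fL eq eq' nl) (⊩exp-transport fe' eq' h')
             (⊩rel-transport fR eq eq' r) d₁' (biFrame-fail f r₁ r₁' d₂)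
    biFrame-fail {B = bwhile _ _ _ _ _ B} (fe , fe' , fL , fR , _ , fB) eq eq' (wRF⇓ nl h' r d) =
      wRF⇓ (¬left-iteration-transport fe fL eq eq' nl) (⊩exp-transport fe' eq' h')
           (⊩rel-transport fR eq eq' r) (biFrame-fail (biR-frame B fB) eq eq' d)
    biFrame-fail f@(fe , fe' , fL , fR , _ , fB) eq eq' (wB⇓ h h' nl nr d₁ d₂) =
      let (_ , _ , d₁' , r₁ , r₁') = biFrame-ok fB eq eq' d₁
      in wB⇓ (⊩exp-transport fe eq h) (⊩exp-transport fe' eq' h')
             (⊩rel-transport-¬ fL eq eq' nl) (⊩rel-transport-¬ fR eq eq' nr) d₁' (biFrame-fail f r₁ r₁' d₂)
    biFrame-fail (fe , fe' , fL , fR , _ , fB) eq eq' (wBF⇓ h h' nl nr d) =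
      wBF⇓ (⊩exp-transport fe eq h) (⊩exp-transport fe' eq' h')
           (⊩rel-transport-¬ fL eq eq' nl) (⊩rel-transport-¬ fR eq eq' nr) (biFrame-fail fB eq eq' d)
    biFrame-fail (fe , fe' , fL , _) eq eq' (wFailL⇓ h h' nl) =
      wFailL⇓ (⊩exp-transport fe eq h) (⊩exp-transport fe' eq' h') (⊩rel-transport-¬ fL eq eq' nl)
    biFrame-fail (fe , fe' , _ , fR , _) eq eq' (wFailR⇓ h h' nr) =
      wFailR⇓ (⊩exp-transport fe eq h) (⊩exp-transport fe' eq' h') (⊩rel-transport-¬ fR eq eq' nr)

cFrame⇒⊩cmd : ∀ c vs → cFrame c vs → ⊩cmd vs c
cFrame⇒⊩cmd c vs f = (λ _ _ _ → cFrame-ok f) , (λ _ _ → cFrame-fail f)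

biFrame⇒⊩bi : ∀ B vs → biFrame B vs → ⊩bi vs B
biFrame⇒⊩bi B vs f = (λ _ _ _ _ _ _ → biFrame-ok f) , (λ _ _ _ _ → biFrame-fail f)

lemma4p14 : ((c : Cmd) (vs : List Var) → cFrame c vs → ⊩cmd vs c)
            × ((B : BiCmd) (vs : List Var) → biFrame B vs → ⊩bi vs B)
lemma4p14 = cFrame⇒⊩cmd , biFrame⇒⊩bi
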